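{- Let $A_1=\{231,312,4321,21543\}$. A permutation belongs to $\operatorname{Av}(A_1)$ if and only if it is of the form $\pi\oplus\sigma\oplus\tau$, where $\pi$ is an increasing permutation (possibly empty), $\sigma$ is either empty or equal to $321$, and $\tau$ is a Fibonacci permutation (possibly empty).
   Context: For a set $S$ of permutations, $\operatorname{Av}(S)$ is the set of all permutations avoiding every pattern in $S$ (in the classical sense: no subsequence is order isomorphic to the pattern). A Fibonacci permutation is a permutation in $\operatorname{Av}(231,312,321)$. For permutations $\pi$ of length $n$ and $\sigma$ of length $k$, $\pi\oplus\sigma$ is $\pi$ followed by $\sigma$ with every entry of $\sigma$ increased by $n$; $\pi\ominus\sigma$ is $\pi$ followed by $\sigma$ with every entry of $\pi$ increased by $k$. -}

module Defs where

open import Data.Nat using (ℕ; zero; suc; _+_; _<_)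
open import Data.List using (List; []; _∷_; _++_; map; length; upTo)
open import Data.List.Relation.Binary.Permutation.Propositional using (_↭_)
open import Data.List.Relation.Binary.Sublist.Propositional using (_⊆_)
open import Data.List.Relation.Unary.All using (All)
open import Data.List.Relation.Unary.Linked using (Linked)
open import Data.Product using (Σ; _×_)
open import Relation.Binary.PropositionalEquality using (_≡_)
open import Relation.Nullary using (¬_)
open import Function.Bundles using (_⇔_)

-- A permutation of length n in one-line notation: a list that is a
-- rearrangement of 1,2,…,n.
IsPerm : List ℕ → Set
IsPerm xs = xs ↭ map suc (upTo (length xs))

-- i-th entry (0-based); default 0 out of range (never used in range checks)
nth : List ℕ → ℕ → ℕ
nth []       _       = 0
nth (x ∷ xs) zero    = x
nth (x ∷ xs) (suc i) = nth xs i

OrderIso : List ℕ → List ℕ → Set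
OrderIso xs ys =
  length xs ≡ length ys ×
  (∀ i j → i < length xs → j < length xs →
     (nth xs i < nth xs j) ⇔ (nth ys i < nth ys j))

Contains : List ℕ → List ℕ → Set
Contains w p = Σ (List ℕ) (λ s → (s ⊆ w) × OrderIso s p)

Avoids : List ℕ → List ℕ → Set
Avoids w p = ¬ Contains w p

InAv : List (List ℕ) → List ℕ → Set
InAv S w = All (Avoids w) S

_⊕_ : List ℕ → List ℕ → List ℕ
π ⊕ σ = π ++ map (length π +_) σ

infixl 6 _⊕_

IsIncreasingPerm : List ℕ → Set
IsIncreasingPerm π = IsPerm π × Linked _<_ π

IsFibonacci : List ℕ → Set
IsFibonacci τ = IsPerm τ × InAv ((2 ∷ 3 ∷ 1 ∷ []) ∷ (3 ∷ 1 ∷ 2 ∷ []) ∷ (3 ∷ 2 ∷ 1 ∷ []) ∷ []) τ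

A₁ : List (List ℕ)
A₁ = (2 ∷ 3 ∷ 1 ∷ []) ∷ (3 ∷ 1 ∷ 2 ∷ []) ∷ (4 ∷ 3 ∷ 2 ∷ 1 ∷ []) ∷ (2 ∷ 1 ∷ 5 ∷ 4 ∷ 3 ∷ []) ∷ []

module Submission where

-- A permutation avoiding 231 and 312 begins with a decreasing run k, k-1, …, 1
-- followed by a shifted permutation: w = descending k ⊕ w′.  Avoiding 4321
-- forces k ≤ 3, and layers of size 1 accumulate into the increasing part π.
-- Once a layer of size 2 or 3 occurs, everything after it avoids 321, since
-- 21 ⊕ 321 = 21543: a layer 21 then makes all of w Fibonacci, while a layer
-- 321 becomes σ.  Conversely, an occurrence of a pattern in a ⊕ b splits along
-- a sum decomposition of the pattern: 231, 312 and 4321 are sum-indecomposable,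
-- and the only decomposition 21 ⊕ 321 of 21543 cannot occur in π ⊕ 321 ⊕ τ,
-- because π is increasing and τ avoids 321.

open import Defs
open import Data.Empty using (⊥-elim)
open import Data.Fin using (Fin; toℕ; fromℕ<)
import Data.Fin.Properties as Fin
open import Data.List
  using (List; []; _∷_; _++_; map; length; take; drop; upTo; downFrom)
open import Data.List.Properties
  using ( length-map; length-++; length-upTo; length-downFrom; map-id; map-id-local; map-∘
        ; map-++; map-cong; map-upTo; ++-assoc; take-all; reverse-upTo; reverse-map)
open import Data.List.Membership.Propositional using (_∈_)
open import Data.List.Membership.Propositional.Properties
  using (∈-map⁺; ∈-map⁻; ∈-upTo⁺; ∈-upTo⁻)
open import Data.List.Relation.Binary.Permutation.Propositional
  using (_↭_; ↭-refl; ↭-sym; ↭-trans; ↭-reflexive; ↭⇒↭ₛ)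
open import Data.List.Relation.Binary.Permutation.Propositional.Properties
  using (∈-resp-↭; drop-∷; ↭-reverse)
import Data.List.Relation.Binary.Permutation.Propositional.Properties as ↭
open import Data.List.Relation.Binary.Permutation.Setoid.Properties using (Unique-resp-↭)
open import Data.List.Relation.Binary.Pointwise using (Pointwise; []; _∷_)
import Data.List.Relation.Binary.Pointwise as Pointwise
open import Data.List.Relation.Binary.Sublist.Propositional
  using (_⊆_; []; _∷_; _∷ʳ_; ⊆-refl; ⊆-trans; from∈)
import Data.List.Relation.Binary.Sublist.Propositional.Properties as Sublist
open import Data.List.Relation.Unary.All using (All; []; _∷_)
import Data.List.Relation.Unary.All as All
import Data.List.Relation.Unary.All.Properties as All
open import Data.List.Relation.Unary.AllPairs using (AllPairs; []; _∷_)
open import Data.List.Relation.Unary.Any using (here; there)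
open import Data.List.Relation.Unary.Linked using (Linked; []; [-]; _∷_; linked?)
import Data.List.Relation.Unary.Linked.Properties as Linked
open import Data.List.Relation.Unary.Unique.Propositional using (Unique)
import Data.List.Relation.Unary.Unique.Propositional.Properties as Unique
open import Data.Nat
  using (ℕ; zero; suc; _+_; _∸_; _<_; _≤_; _>_; s≤s; z<s; _≤′_; ≤′-refl; ≤′-step)
open import Data.Nat.Induction using (<-wellFounded)
open import Data.Nat.Properties
open import Data.Product using (Σ; Σ-syntax; _×_; _,_; proj₁; proj₂)
open import Data.Sum using (_⊎_; inj₁; inj₂; [_,_]′)
open import Data.Unit using (⊤; tt)
open import Function using (_∘_; const)
open import Function.Bundles using (_⇔_; mk⇔; Equivalence)
import Function.Properties.Equivalence as ⇔
open import Induction.WellFounded using (Acc; acc)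
open import Relation.Binary.Definitions using (Transitive; tri<; tri≈; tri>)
open import Relation.Binary.PropositionalEquality
open import Relation.Nullary using (¬_; Dec; ¬?; _×-dec_)
open import Relation.Nullary.Decidable using (from-yes; from-no)

private
  variable
    x y : ℕ
    a b p q s w w′ xs ys zs xs′ ys′ : List ℕ

-- Order isomorphism

SameCmp : ℕ → ℕ → ℕ → ℕ → Set
SameCmp x y x′ y′ = (x < x′ ⇔ y < y′) × (x′ < x ⇔ y′ < y)

-- OrderIso by structural recursion: each entry compares with every later
-- entry as the corresponding entry of the other list does.
data SameOrder : List ℕ → List ℕ → Set where
  []  : SameOrder [] []
  _∷_ : Pointwise (SameCmp x y) xs ys → SameOrder xs ys → SameOrder (x ∷ xs) (y ∷ ys)

Pointwise-nth : ∀ {R : ℕ → ℕ → Set} {i} → Pointwise R xs ys → i < length xs →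
                R (nth xs i) (nth ys i)
Pointwise-nth {i = zero}  (r ∷ _)  _        = r
Pointwise-nth {i = suc i} (_ ∷ rs) (s≤s i<) = Pointwise-nth rs i<

Pointwise-from-nth : ∀ {R : ℕ → ℕ → Set} xs ys → length xs ≡ length ys →
                     (∀ i → i < length xs → R (nth xs i) (nth ys i)) → Pointwise R xs ys
Pointwise-from-nth []       []       _   _ = []
Pointwise-from-nth (x ∷ xs) (y ∷ ys) len r =
  r 0 z<s ∷ Pointwise-from-nth xs ys (suc-injective len) (λ i i< → r (suc i) (s≤s i<))

SameOrder⇒OrderIso : SameOrder xs ys → OrderIso xs ys
SameOrder⇒OrderIso []      = refl , λ _ _ ()
SameOrder⇒OrderIso (c ∷ o) = cong suc (Pointwise.Pointwise-length c) , cmp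
  where
  cmp : ∀ i j → i < suc _ → j < suc _ → _
  cmp zero    zero    _        _        = mk⇔ (⊥-elim ∘ n≮n _) (⊥-elim ∘ n≮n _)
  cmp zero    (suc j) _        (s≤s j<) = proj₁ (Pointwise-nth c j<)
  cmp (suc i) zero    (s≤s i<) _        = proj₂ (Pointwise-nth c i<)
  cmp (suc i) (suc j) (s≤s i<) (s≤s j<) = proj₂ (SameOrder⇒OrderIso o) i j i< j<

OrderIso⇒SameOrder : ∀ xs ys → OrderIso xs ys → SameOrder xs ys
OrderIso⇒SameOrder []       []       _           = []
OrderIso⇒SameOrder (x ∷ xs) (y ∷ ys) (len , iso) =
  Pointwise-from-nth xs ys len′ (λ j j< → iso 0 (suc j) z<s (s≤s j<) , iso (suc j) 0 (s≤s j<) z<s)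
  ∷ OrderIso⇒SameOrder xs ys (len′ , λ i j i< j< → iso (suc i) (suc j) (s≤s i<) (s≤s j<))
  where len′ = suc-injective len

SameOrder-refl : ∀ xs → SameOrder xs xs
SameOrder-refl xs = OrderIso⇒SameOrder xs xs (refl , λ _ _ _ _ → ⇔.refl)

SameOrder-sym : SameOrder xs ys → SameOrder ys xs
SameOrder-sym []      = []
SameOrder-sym (c ∷ o) =
  Pointwise.symmetric (λ (f , g) → ⇔.sym f , ⇔.sym g) c ∷ SameOrder-sym o

SameOrder-trans : SameOrder xs ys → SameOrder ys zs → SameOrder xs zs
SameOrder-trans []      []        = []
SameOrder-trans (c ∷ o) (c′ ∷ o′) =
  Pointwise.transitive (λ (f , g) (f′ , g′) → ⇔.trans f f′ , ⇔.trans g g′) c c′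
  ∷ SameOrder-trans o o′

SameOrder-map : ∀ {P : ℕ → Set} (f : ℕ → ℕ) → (∀ {a b} → P a → P b → a < b → f a < f b) →
                All P xs → SameOrder (map f xs) xs
SameOrder-map {P = P} f mono []         = []
SameOrder-map {P = P} f mono (px ∷ pxs) = cmps px pxs ∷ SameOrder-map f mono pxs
  where
  mono⇔ : ∀ {a b} → P a → P b → f a < f b ⇔ a < b
  mono⇔ {a} {b} pa pb = mk⇔ reflect (mono pa pb)
    where
    reflect : f a < f b → a < b
    reflect fa<fb with <-cmp a b
    ... | tri< a<b _ _  = a<b
    ... | tri≈ _ refl _ = ⊥-elim (n≮n _ fa<fb)
    ... | tri> _ _ b<a  = ⊥-elim (<-asym fa<fb (mono pb pa b<a))
  cmps : ∀ {a bs} → P a → All P bs → Pointwise (SameCmp (f a) a) (map f bs) bs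
  cmps pa []         = []
  cmps pa (pb ∷ pbs) = (mono⇔ pa pb , mono⇔ pb pa) ∷ cmps pa pbs

SameOrder-shift : ∀ c xs → SameOrder (map (c +_) xs) xs
SameOrder-shift c xs =
  SameOrder-map {P = λ _ → ⊤} (c +_) (λ _ _ → +-monoʳ-< c) (All.universal (const tt) xs)

Linked-nth : ∀ {t i j} → Linked _<_ t → i < j → j < length t → nth t i < nth t j
Linked-nth {j = suc zero}    (h ∷ _) z<s       _        = h
Linked-nth {j = suc (suc j)} (h ∷ l) z<s       (s≤s j<) = <-trans h (Linked-nth l z<s j<)
Linked-nth {i = suc i}       (_ ∷ l) (s≤s i<j) (s≤s j<) = Linked-nth l i<j j<
Linked-nth [-] z<s     (s≤s ())
Linked-nth [-] (s≤s _) (s≤s ())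

Within : ℕ → List ℕ → Set
Within n = All (λ v → 0 < v × v ≤ n)

Within? : ∀ n p → Dec (Within n p)
Within? n = All.all? (λ v → (0 <? v) ×-dec (v ≤? n))

-- An increasing list t realises every pattern over 1 … length t: the value v
-- is played by the v-th smallest entry of t.
SameOrder-chain : ∀ {t} → Linked _<_ t → Within (length t) p →
                  SameOrder (map (λ v → nth t (v ∸ 1)) p) p
SameOrder-chain {t = t} l = SameOrder-map (λ v → nth t (v ∸ 1)) mono
  where
  mono : ∀ {a b} → 0 < a × a ≤ length t → 0 < b × b ≤ length t → a < b →
         nth t (a ∸ 1) < nth t (b ∸ 1)
  mono (z<s , _) (z<s , b≤) (s≤s a<b) = Linked-nth l a<b b≤

AllBelow : List ℕ → List ℕ → Set
AllBelow xs ys = All (λ x → All (x <_) ys) xs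

SameOrder-++ : SameOrder xs ys → SameOrder xs′ ys′ → AllBelow xs xs′ → AllBelow ys ys′ →
               SameOrder (xs ++ xs′) (ys ++ ys′)
SameOrder-++ []      o′ _          _          = o′
SameOrder-++ (c ∷ o) o′ (bx ∷ bxs) (by ∷ bys) =
  Pointwise.++⁺ c (below o′ bx by) ∷ SameOrder-++ o o′ bxs bys
  where
  below : SameOrder xs′ ys′ → All (x <_) xs′ → All (y <_) ys′ → Pointwise (SameCmp x y) xs′ ys′
  below []      []         []         = []
  below (_ ∷ o) (x< ∷ x<s) (y< ∷ y<s) =
    (mk⇔ (const y<) (const x<) , mk⇔ (⊥-elim ∘ <-asym x<) (⊥-elim ∘ <-asym y<)) ∷ below o x<s y<s

Pointwise-split : ∀ {R : ℕ → ℕ → Set} xs {ys} → Pointwise R (xs ++ xs′) ys →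
                  Pointwise R xs (take (length xs) ys) × Pointwise R xs′ (drop (length xs) ys)
Pointwise-split []       rs       = [] , rs
Pointwise-split (x ∷ xs) (r ∷ rs) = let rs₁ , rs₂ = Pointwise-split xs rs in r ∷ rs₁ , rs₂

SameOrder-split : ∀ xs {ys} → SameOrder (xs ++ xs′) ys →
                  SameOrder xs (take (length xs) ys) × SameOrder xs′ (drop (length xs) ys)
SameOrder-split []       o       = [] , o
SameOrder-split (x ∷ xs) (c ∷ o) =
  let o₁ , o₂ = SameOrder-split xs o in proj₁ (Pointwise-split xs c) ∷ o₁ , o₂

AllBelow-split : ∀ xs {ys} → SameOrder (xs ++ xs′) ys → AllBelow xs xs′ →
                 AllBelow (take (length xs) ys) (drop (length xs) ys)
AllBelow-split []       _       []         = []
AllBelow-split (x ∷ xs) (c ∷ o) (bx ∷ bxs) =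
  transport (proj₂ (Pointwise-split xs c)) bx ∷ AllBelow-split xs o bxs
  where
  transport : ∀ {zs ws} → Pointwise (SameCmp x y) zs ws → All (x <_) zs → All (y <_) ws
  transport []       []         = []
  transport (c ∷ cs) (x< ∷ x<s) = Equivalence.to (proj₁ c) x< ∷ transport cs x<s

Linked-resp-SameOrder : ∀ {R : ℕ → ℕ → Set} →
  (∀ {x y x′ y′} → SameCmp x y x′ y′ → R x x′ → R y y′) →
  SameOrder xs ys → Linked R xs → Linked R ys
Linked-resp-SameOrder resp []            []      = []
Linked-resp-SameOrder resp ([] ∷ [])     [-]     = [-]
Linked-resp-SameOrder resp ((c ∷ _) ∷ o) (r ∷ l) = resp c r ∷ Linked-resp-SameOrder resp o l

-- Pattern containment

occurrence : Contains w p → Σ[ s ∈ List ℕ ] s ⊆ w × SameOrder s p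
occurrence (s , τ , iso) = s , τ , OrderIso⇒SameOrder s _ iso

contains : s ⊆ w → SameOrder s p → Contains w p
contains τ o = _ , τ , SameOrder⇒OrderIso o

Contains-⊆ : w ⊆ w′ → Contains w p → Contains w′ p
Contains-⊆ {p = p} τ′ c = let _ , τ , o = occurrence {p = p} c in contains (⊆-trans τ τ′) o

Contains-resp : SameOrder p q → Contains w p → Contains w q
Contains-resp {p = p} o′ c = let _ , τ , o = occurrence {p = p} c in contains τ (SameOrder-trans o o′)

Contains-length : Contains w p → length p ≤ length w
Contains-length (_ , τ , len , _) = subst (_≤ _) len (Sublist.length-mono-≤ τ)

Contains-suffix : ∀ p → Contains w (p ++ q) → Contains w q
Contains-suffix {q = q} p c with occurrence {p = p ++ q} c
... | s , τ , o = contains (⊆-trans (Sublist.drop-⊆ (length p) s) τ)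
                           (SameOrder-sym (proj₂ (SameOrder-split p (SameOrder-sym o))))

Contains-chain : ∀ {t} p → Linked _<_ t → Within (length t) p →
                 map (λ v → nth t (v ∸ 1)) p ⊆ w → Contains w p
Contains-chain p l within τ = contains τ (SameOrder-chain l within)

AllPairs-resp-⊆ : ∀ {R : ℕ → ℕ → Set} → s ⊆ w → AllPairs R w → AllPairs R s
AllPairs-resp-⊆ []         []       = []
AllPairs-resp-⊆ (_ ∷ʳ τ)   (_ ∷ rs) = AllPairs-resp-⊆ τ rs
AllPairs-resp-⊆ (refl ∷ τ) (r ∷ rs) = Sublist.All-resp-⊆ τ r ∷ AllPairs-resp-⊆ τ rs

Linked-Contains : ∀ {R : ℕ → ℕ → Set} → Transitive R →
  (∀ {x y x′ y′} → SameCmp x y x′ y′ → R x x′ → R y y′) →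
  Linked R w → Contains w p → Linked R p
Linked-Contains {p = p} trans resp l c with occurrence {p = p} c
... | _ , τ , o = Linked-resp-SameOrder resp o
                    (Linked.AllPairs⇒Linked (AllPairs-resp-⊆ τ (Linked.Linked⇒AllPairs trans l)))

increasing-avoids : Linked _<_ w → ¬ Linked _<_ p → Avoids w p
increasing-avoids {p = p} l ¬inc = ¬inc ∘ Linked-Contains {p = p} <-trans (Equivalence.to ∘ proj₁) l

decreasing-contains : Linked _>_ w → Contains w p → Linked _>_ p
decreasing-contains {p = p} =
  Linked-Contains {p = p} (λ x>y y>z → <-trans y>z x>y) (Equivalence.to ∘ proj₂)

InAv-increasing : ∀ {S} → Linked _<_ w → All (¬_ ∘ Linked _<_) S → InAv S w
InAv-increasing l = All.map (increasing-avoids l)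

-- Direct sums

InRange : List ℕ → Set
InRange w = Within (length w) w

length-⊕ : ∀ a b → length (a ⊕ b) ≡ length a + length b
length-⊕ a b = trans (length-++ a) (cong (length a +_) (length-map (length a +_) b))

⊕-assoc : ∀ a b c → (a ⊕ b) ⊕ c ≡ a ⊕ (b ⊕ c)
⊕-assoc a b c = begin
  (a ++ map (length a +_) b) ++ map (length (a ⊕ b) +_) c
    ≡⟨ ++-assoc a _ _ ⟩
  a ++ map (length a +_) b ++ map (length (a ⊕ b) +_) c
    ≡⟨ cong (λ l → a ++ map (length a +_) b ++ l) (trans (map-cong shift c) (map-∘ c)) ⟩
  a ++ map (length a +_) b ++ map (length a +_) (map (length b +_) c)
    ≡⟨ cong (a ++_) (map-++ (length a +_) b _) ⟨
  a ++ map (length a +_) (b ++ map (length b +_) c) ∎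
  where
  open ≡-Reasoning
  shift : ∀ x → length (a ⊕ b) + x ≡ length a + (length b + x)
  shift x = trans (cong (_+ x) (length-⊕ a b)) (+-assoc (length a) (length b) x)

AllBelow-⊕ : ∀ {n} → All (_≤ n) xs → All (0 <_) ys → AllBelow xs (map (n +_) ys)
AllBelow-⊕ {n = n} xs≤ 0<ys =
  All.map (λ x≤ → All.map⁺ (All.map (λ 0<y → ≤-<-trans x≤ (m<m+n n 0<y)) 0<ys)) xs≤

Contains-⊕ˡ : Contains a p → Contains (a ⊕ b) p
Contains-⊕ˡ {a = a} {p = p} {b = b} = Contains-⊆ {p = p} (Sublist.++⁺ʳ (map (length a +_) b) ⊆-refl)

Contains-⊕ʳ : Contains b p → Contains (a ⊕ b) p
Contains-⊕ʳ {p = p} {a = a} c with occurrence {p = p} c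
... | s , τ , o = contains (Sublist.++⁺ˡ a (Sublist.map⁺ (length a +_) τ))
                           (SameOrder-trans (SameOrder-shift (length a) s) o)

⊕-contains : InRange a → InRange b → InRange p → InRange q →
             Contains a p → Contains b q → Contains (a ⊕ b) (p ⊕ q)
⊕-contains {a} {b} {p} {q} ra rb rp rq cp cq with occurrence {p = p} cp | occurrence {p = q} cq
... | s₁ , τ₁ , o₁ | s₂ , τ₂ , o₂ =
  contains (Sublist.++⁺ τ₁ (Sublist.map⁺ (length a +_) τ₂))
    (SameOrder-++ o₁ shifted
      (AllBelow-⊕ (Sublist.All-resp-⊆ τ₁ (All.map proj₂ ra)) (Sublist.All-resp-⊆ τ₂ (All.map proj₁ rb)))
      (AllBelow-⊕ (All.map proj₂ rp) (All.map proj₁ rq)))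
  where
  shifted : SameOrder (map (length a +_) s₂) (map (length p +_) q)
  shifted = SameOrder-trans (SameOrder-shift (length a) s₂)
              (SameOrder-trans o₂ (SameOrder-sym (SameOrder-shift (length p) q)))

⊆-++⁻ : ∀ a {b s} → s ⊆ a ++ b →
        Σ[ s₁ ∈ List ℕ ] Σ[ s₂ ∈ List ℕ ] s ≡ s₁ ++ s₂ × s₁ ⊆ a × s₂ ⊆ b
⊆-++⁻ []      τ          = [] , _ , refl , [] , τ
⊆-++⁻ (x ∷ a) (_ ∷ʳ τ)   with ⊆-++⁻ a τ
... | s₁ , s₂ , refl , τ₁ , τ₂ = s₁ , s₂ , refl , x ∷ʳ τ₁ , τ₂
⊆-++⁻ (x ∷ a) (refl ∷ τ) with ⊆-++⁻ a τ
... | s₁ , s₂ , refl , τ₁ , τ₂ = x ∷ s₁ , s₂ , refl , refl ∷ τ₁ , τ₂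

⊆-map⁻ : ∀ (f : ℕ → ℕ) b {s} → s ⊆ map f b → Σ[ s′ ∈ List ℕ ] s ≡ map f s′ × s′ ⊆ b
⊆-map⁻ f []      []         = [] , refl , []
⊆-map⁻ f (x ∷ b) (_ ∷ʳ τ)   with ⊆-map⁻ f b τ
... | s′ , refl , τ′ = s′ , refl , x ∷ʳ τ′
⊆-map⁻ f (x ∷ b) (refl ∷ τ) with ⊆-map⁻ f b τ
... | s′ , refl , τ′ = x ∷ s′ , refl , refl ∷ τ′

SumSplit : List ℕ → ℕ → Set
SumSplit p k = AllBelow (take k p) (drop k p)

sumSplit? : ∀ p k → Dec (SumSplit p k)
sumSplit? p k = All.all? (λ x → All.all? (x <?_) (drop k p)) (take k p)

⊕-split-at : InRange a → InRange b → Contains (a ⊕ b) p →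
  Σ[ k ∈ ℕ ] SumSplit p k × Contains a (take k p) × Contains b (drop k p)
⊕-split-at {a} {b} {p} ra rb c with occurrence {p = p} c
... | s , τ , o with ⊆-++⁻ a τ
... | s₁ , s₂ , refl , τ₁ , τ₂ with ⊆-map⁻ (length a +_) b τ₂
... | s₂′ , refl , τ₂′ =
  length s₁ ,
  AllBelow-split s₁ o (AllBelow-⊕ (Sublist.All-resp-⊆ τ₁ (All.map proj₂ ra))
                                  (Sublist.All-resp-⊆ τ₂′ (All.map proj₁ rb))) ,
  contains τ₁ (proj₁ (SameOrder-split s₁ o)) ,
  contains τ₂′ (SameOrder-trans (SameOrder-sym (SameOrder-shift (length a) s₂′))
                                (proj₂ (SameOrder-split s₁ o)))

⊕-split : InRange a → InRange b → Contains (a ⊕ b) p →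
  Contains a p ⊎ Contains b p ⊎
  Σ[ k ∈ ℕ ] 0 < k × k < length p × SumSplit p k × Contains a (take k p) × Contains b (drop k p)
⊕-split {p = p} ra rb c with ⊕-split-at ra rb c
... | zero  , _     , _  , cb = inj₂ (inj₁ cb)
... | suc k , split , ca , cb =
  [ (λ p≤k → inj₁ (subst (Contains _) (take-all (suc k) p p≤k) ca))
  , (λ k<p → inj₂ (inj₂ (suc k , z<s , k<p , split , ca , cb))) ]′ (≤-<-connex (length p) (suc k))

SumIndecomposable : List ℕ → Set
SumIndecomposable p = ∀ (i : Fin (length p ∸ 1)) → ¬ SumSplit p (suc (toℕ i))

sumIndecomposable? : ∀ p → Dec (SumIndecomposable p)
sumIndecomposable? p = Fin.all? (λ i → ¬? (sumSplit? p (suc (toℕ i))))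

⊕-split-indecomposable : SumIndecomposable p → InRange a → InRange b →
                         Contains (a ⊕ b) p → Contains a p ⊎ Contains b p
⊕-split-indecomposable {p = p} indec ra rb c with ⊕-split ra rb c
... | inj₁ ca        = inj₁ ca
... | inj₂ (inj₁ cb) = inj₂ cb
... | inj₂ (inj₂ (suc k , _ , k<p , split , _)) =
  ⊥-elim (indec (fromℕ< k<) (subst (SumSplit p ∘ suc) (sym (Fin.toℕ-fromℕ< k<)) split))
  where
  k< : k < length p ∸ 1
  k< = ∸-monoˡ-< k<p z<s

-- Permutations

ascending descending : ℕ → List ℕ
ascending n  = map suc (upTo n)
descending n = map suc (downFrom n)

length-ascending : ∀ n → length (ascending n) ≡ n
length-ascending n = trans (length-map suc (upTo n)) (length-upTo n)

length-descending : ∀ n → length (descending n) ≡ n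
length-descending n = trans (length-map suc (downFrom n)) (length-downFrom n)

ascending-suc : ∀ n → ascending (suc n) ≡ (1 ∷ []) ⊕ ascending n
ascending-suc n = cong (λ l → 1 ∷ map suc l) (sym (map-upTo suc n))

ascending-+ : ∀ m n → ascending (m + n) ≡ ascending m ++ map (m +_) (ascending n)
ascending-+ zero    n = sym (map-id (ascending n))
ascending-+ (suc m) n = begin
  ascending (suc m + n)
    ≡⟨ ascending-suc (m + n) ⟩
  1 ∷ map suc (ascending (m + n))
    ≡⟨ cong (λ l → 1 ∷ map suc l) (ascending-+ m n) ⟩
  1 ∷ map suc (ascending m ++ map (m +_) (ascending n))
    ≡⟨ cong (1 ∷_) (map-++ suc (ascending m) _) ⟩
  1 ∷ map suc (ascending m) ++ map suc (map (m +_) (ascending n))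
    ≡⟨ cong (λ l → 1 ∷ map suc (ascending m) ++ l) (map-∘ (ascending n)) ⟨
  1 ∷ map suc (ascending m) ++ map (suc m +_) (ascending n)
    ≡⟨ cong (_++ map (suc m +_) (ascending n)) (ascending-suc m) ⟨
  ascending (suc m) ++ map (suc m +_) (ascending n) ∎
  where open ≡-Reasoning

Linked-ascending : ∀ n → Linked _<_ (ascending n)
Linked-ascending n =
  subst (Linked _<_) (sym (map-upTo suc n)) (Linked.applyUpTo⁺₂ suc n (λ i → n<1+n (suc i)))

IsPerm-ascending : ∀ n → IsPerm (ascending n)
IsPerm-ascending n = ↭-reflexive (cong ascending (sym (length-ascending n)))

IsPerm-descending : ∀ n → IsPerm (descending n)
IsPerm-descending n = subst (λ l → descending n ↭ ascending l) (sym (length-descending n)) reversed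
  where
  reversed : descending n ↭ ascending n
  reversed = subst (_↭ ascending n)
               (trans (sym (reverse-map suc (upTo n))) (cong (map suc) (reverse-upTo n)))
               (↭-reverse (ascending n))

∈-ascending⁻ : ∀ {n} → x ∈ ascending n → 0 < x × x ≤ n
∈-ascending⁻ x∈ with ∈-map⁻ suc x∈
... | i , i∈ , refl = z<s , ∈-upTo⁻ i∈

∈-ascending⁺ : ∀ {n} → 0 < x → x ≤ n → x ∈ ascending n
∈-ascending⁺ {x = suc x} _ x≤n = ∈-map⁺ suc (∈-upTo⁺ x≤n)

IsPerm⇒InRange : IsPerm w → InRange w
IsPerm⇒InRange pw = All.tabulate (∈-ascending⁻ ∘ ∈-resp-↭ pw)

IsPerm⇒Unique : IsPerm w → Unique w
IsPerm⇒Unique {w} pw =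
  Unique-resp-↭ (setoid ℕ) (↭⇒↭ₛ (↭-sym pw)) (Unique.map⁺ suc-injective (Unique.upTo⁺ (length w)))

IsPerm-⊕ : IsPerm a → IsPerm b → IsPerm (a ⊕ b)
IsPerm-⊕ {a} {b} pa pb = ↭-trans (↭.++⁺ pa (↭.map⁺ (length a +_) pb))
  (↭-reflexive (trans (sym (ascending-+ (length a) (length b))) (cong ascending (sym (length-⊕ a b)))))

↭-cancelˡ : ∀ xs → xs ++ ys ↭ xs ++ zs → ys ↭ zs
↭-cancelˡ []       p = p
↭-cancelˡ (x ∷ xs) p = ↭-cancelˡ xs (drop-∷ p)

IsPerm-++⁻ : ∀ a {r} → IsPerm (a ++ r) → IsPerm a → Σ[ w ∈ List ℕ ] IsPerm w × a ++ r ≡ a ⊕ w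
IsPerm-++⁻ a {r} par pa = map (_∸ n) r , perm , cong (a ++_) (sym unshift)
  where
  n = length a
  m = length r
  r↭ : r ↭ map (n +_) (ascending m)
  r↭ = ↭-cancelˡ (ascending n) (↭-trans (↭.++⁺ʳ r (↭-sym pa))
         (↭-trans par (↭-reflexive (trans (cong ascending (length-++ a)) (ascending-+ n m)))))
  unshift : map (n +_) (map (_∸ n) r) ≡ r
  unshift = trans (sym (map-∘ r)) (map-id-local (All.tabulate (n+[x∸n]≡x ∘ ∈-resp-↭ r↭)))
    where
    n+[x∸n]≡x : x ∈ map (n +_) (ascending m) → n + (x ∸ n) ≡ x
    n+[x∸n]≡x x∈ with ∈-map⁻ (n +_) x∈
    ... | y , _ , refl = cong (n +_) (m+n∸m≡n n y)
  perm : IsPerm (map (_∸ n) r)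
  perm = subst (λ l → map (_∸ n) r ↭ ascending l) (sym (length-map (_∸ n) r))
           (↭-trans (↭.map⁺ (_∸ n) r↭)
             (↭-reflexive (trans (sym (map-∘ (ascending m)))
               (map-id-local (All.universal (m+n∸m≡n n) (ascending m))))))

descending-⊆ : ∀ {m n} → m ≤′ n → descending m ⊆ descending n
descending-⊆ ≤′-refl        = ⊆-refl
descending-⊆ (≤′-step m≤n) = _ ∷ʳ descending-⊆ m≤n

Contains-descending : ∀ {m n} → m ≤ n → Contains (descending n) (descending m)
Contains-descending m≤n = contains (descending-⊆ (≤⇒≤′ m≤n)) (SameOrder-refl _)

-- Layers of Av(231, 312)

[2,1] [2,3,1] [3,1,2] [3,2,1] [4,3,2,1] [2,1,5,4,3] : List ℕ
[2,1]       = 2 ∷ 1 ∷ []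
[2,3,1]     = 2 ∷ 3 ∷ 1 ∷ []
[3,1,2]     = 3 ∷ 1 ∷ 2 ∷ []
[3,2,1]     = 3 ∷ 2 ∷ 1 ∷ []
[4,3,2,1]   = 4 ∷ 3 ∷ 2 ∷ 1 ∷ []
[2,1,5,4,3] = 2 ∷ 1 ∷ 5 ∷ 4 ∷ 3 ∷ []

∈-tail : ∀ {u} → x ∈ y ∷ u → x ≢ y → x ∈ u
∈-tail (here x≡y) x≢y = ⊥-elim (x≢y x≡y)
∈-tail (there x∈) _   = x∈

-- The entry y after k+1 must be k: with k still to come, y < k would give
-- the 312 (k+1, y, k), and y > k+1 the 231 (k+1, y, k).
descending-prefix : ∀ k {u} → Unique (suc k ∷ u) →
  Avoids (suc k ∷ u) [2,3,1] → Avoids (suc k ∷ u) [3,1,2] →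
  (∀ {j} → 0 < j → j ≤ k → j ∈ u) → Σ[ r ∈ List ℕ ] suc k ∷ u ≡ descending (suc k) ++ r
descending-prefix zero    {u}     _ _ _ _ = u , refl
descending-prefix (suc k) {[]}    _ _ _ has with () ← has z<s ≤-refl
descending-prefix (suc k) {y ∷ u} (k+2∉ ∷ unique) ¬231 ¬312 has with <-cmp y (suc k)
... | tri≈ _ refl _ =
  let r , eq = descending-prefix k unique (¬231 ∘ Contains-⊆ {p = [2,3,1]} (_ ∷ʳ ⊆-refl))
                                          (¬312 ∘ Contains-⊆ {p = [3,1,2]} (_ ∷ʳ ⊆-refl)) has′
  in r , cong (suc (suc k) ∷_) eq
  where
  has′ : ∀ {j} → 0 < j → j ≤ k → j ∈ u
  has′ 0<j j≤k = ∈-tail (has 0<j (m≤n⇒m≤1+n j≤k)) (<⇒≢ (s≤s j≤k))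
... | tri< y<k+1 y≢k+1 _ =
  ⊥-elim (¬312 (Contains-chain [3,1,2] (y<k+1 ∷ n<1+n (suc k) ∷ [-]) (from-yes (Within? 3 [3,1,2]))
                               (refl ∷ refl ∷ from∈ (∈-tail (has z<s ≤-refl) (y≢k+1 ∘ sym)))))
... | tri> _ y≢k+1 k+1<y =
  ⊥-elim (¬231 (Contains-chain [2,3,1] (n<1+n (suc k) ∷ k+2<y ∷ [-]) (from-yes (Within? 3 [2,3,1]))
                               (refl ∷ refl ∷ from∈ (∈-tail (has z<s ≤-refl) (y≢k+1 ∘ sym)))))
  where
  k+2<y : suc (suc k) < y
  k+2<y = ≤∧≢⇒< k+1<y (All.head k+2∉)

first-layer : IsPerm w → Avoids w [2,3,1] → Avoids w [3,1,2] → w ≢ [] →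
  Σ[ k ∈ ℕ ] Σ[ w′ ∈ List ℕ ] 0 < k × IsPerm w′ × w ≡ descending k ⊕ w′
first-layer {[]}    _  _    _    w≢[] = ⊥-elim (w≢[] refl)
first-layer {x ∷ u} pw ¬231 ¬312 _ with IsPerm⇒InRange pw
... | (z<s {k} , x≤n) ∷ _ =
  let r , eq         = descending-prefix k (IsPerm⇒Unique pw) ¬231 ¬312 has
      w′ , pw′ , eq′ = IsPerm-++⁻ (descending (suc k)) (subst IsPerm eq pw) (IsPerm-descending (suc k))
  in suc k , w′ , z<s , pw′ , trans eq eq′
  where
  has : ∀ {j} → 0 < j → j ≤ k → j ∈ u
  has 0<j j≤k = ∈-tail (∈-resp-↭ (↭-sym pw) (∈-ascending⁺ 0<j (≤-trans (m≤n⇒m≤1+n j≤k) x≤n)))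
                       (<⇒≢ (s≤s j≤k))

-- Av(A₁)

indecomposable-231 : SumIndecomposable [2,3,1]
indecomposable-231 = from-yes (sumIndecomposable? [2,3,1])

indecomposable-312 : SumIndecomposable [3,1,2]
indecomposable-312 = from-yes (sumIndecomposable? [3,1,2])

indecomposable-321 : SumIndecomposable [3,2,1]
indecomposable-321 = from-yes (sumIndecomposable? [3,2,1])

indecomposable-4321 : SumIndecomposable [4,3,2,1]
indecomposable-4321 = from-yes (sumIndecomposable? [4,3,2,1])

A₁-nonincreasing : All (¬_ ∘ Linked _<_) A₁
A₁-nonincreasing = from-yes (All.all? (¬? ∘ linked? _<?_) A₁)

[3,2,1]-avoids-A₁ : InAv A₁ [3,2,1]
[3,2,1]-avoids-A₁ =
  All.map (λ {p} ¬short c → ¬short (decreasing-contains {p = p} decreasing c , Contains-length {p = p} c))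
          (from-yes (All.all? (λ p → ¬? (linked? _>?_ p ×-dec length p ≤? 3)) A₁))
  where
  decreasing : Linked _>_ [3,2,1]
  decreasing = from-yes (linked? _>?_ [3,2,1])

Fibonacci-avoids-A₁ : IsFibonacci w → InAv A₁ w
Fibonacci-avoids-A₁ (_ , ¬231 ∷ ¬312 ∷ ¬321 ∷ []) =
  ¬231 ∷ ¬312 ∷ ¬321 ∘ Contains-suffix (4 ∷ [])
  ∷ ¬321 ∘ Contains-resp (SameOrder-shift 2 [3,2,1]) ∘ Contains-suffix [2,1] ∷ []

⊕-avoids-A₁ : IsPerm a → IsPerm b → InAv A₁ a → InAv A₁ b →
              (Contains a [2,1] → Avoids b [3,2,1]) → InAv A₁ (a ⊕ b)
⊕-avoids-A₁ {a} {b} pa pb (a231 ∷ a312 ∷ a4321 ∷ a21543 ∷ []) (b231 ∷ b312 ∷ b4321 ∷ b21543 ∷ []) cross =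
  indecomposable indecomposable-231 a231 b231 ∷ indecomposable indecomposable-312 a312 b312
  ∷ indecomposable indecomposable-4321 a4321 b4321 ∷ avoid21543 ∷ []
  where
  ra = IsPerm⇒InRange pa
  rb = IsPerm⇒InRange pb
  indecomposable : SumIndecomposable p → Avoids a p → Avoids b p → Avoids (a ⊕ b) p
  indecomposable indec ¬ca ¬cb = [ ¬ca , ¬cb ]′ ∘ ⊕-split-indecomposable indec ra rb
  -- the only proper sum decomposition of 21543 is 21 ⊕ 321
  avoid21543 : Avoids (a ⊕ b) [2,1,5,4,3]
  avoid21543 c with ⊕-split ra rb c
  ... | inj₁ ca                                   = a21543 ca
  ... | inj₂ (inj₁ cb)                            = b21543 cb
  ... | inj₂ (inj₂ (1 , _ , _ , split , _))       = from-no (sumSplit? [2,1,5,4,3] 1) split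
  ... | inj₂ (inj₂ (2 , _ , _ , _ , ca , cb))     = cross ca (Contains-resp (SameOrder-shift 2 [3,2,1]) cb)
  ... | inj₂ (inj₂ (3 , _ , _ , split , _))       = from-no (sumSplit? [2,1,5,4,3] 3) split
  ... | inj₂ (inj₂ (4 , _ , _ , split , _))       = from-no (sumSplit? [2,1,5,4,3] 4) split
  ... | inj₂ (inj₂ (suc (suc (suc (suc (suc _)))) , _ , s≤s (s≤s (s≤s (s≤s (s≤s ())))) , _))

A₁Form : List ℕ → Set
A₁Form w = Σ (List ℕ) (λ π → Σ (List ℕ) (λ σ → Σ (List ℕ) (λ τ →
  IsIncreasingPerm π × (σ ≡ [] ⊎ σ ≡ [3,2,1]) × IsFibonacci τ × w ≡ π ⊕ σ ⊕ τ)))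

A₁Form⇒InAv : A₁Form w → InAv A₁ w
A₁Form⇒InAv (π , σ , τ , (pπ , lπ) , σ-shape , fτ@(pτ , _ ∷ _ ∷ ¬321 ∷ []) , refl) =
  ⊕-avoids-A₁ (IsPerm-⊕ pπ pσ) pτ
    (⊕-avoids-A₁ pπ pσ (InAv-increasing lπ A₁-nonincreasing) σ-avoids
                 (⊥-elim ∘ increasing-avoids lπ (from-no (linked? _<?_ [2,1]))))
    (Fibonacci-avoids-A₁ fτ) (λ _ → ¬321)
  where
  pσ : IsPerm σ
  pσ = [ (λ { refl → ↭-refl }) , (λ { refl → IsPerm-descending 3 }) ]′ σ-shape
  σ-avoids : InAv A₁ σ
  σ-avoids = [ (λ { refl → InAv-increasing [] A₁-nonincreasing }) , (λ { refl → [3,2,1]-avoids-A₁ }) ]′ σ-shape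

Layered : List ℕ → Set
Layered w = Σ[ n ∈ ℕ ] Σ[ σ ∈ List ℕ ] Σ[ τ ∈ List ℕ ]
  (σ ≡ [] ⊎ σ ≡ [3,2,1]) × IsFibonacci τ × w ≡ ascending n ⊕ σ ⊕ τ

InAv-⊕ʳ : ∀ {S} → InAv S (a ⊕ b) → InAv S b
InAv-⊕ʳ = All.map (λ {p} ¬c → ¬c ∘ Contains-⊕ʳ {p = p})

-- descending k contains 21, and 21 ⊕ 321 = 21543
after-layer-avoids-321 : ∀ k → 2 ≤ k → IsPerm w′ → Avoids (descending k ⊕ w′) [2,1,5,4,3] →
                         Avoids w′ [3,2,1]
after-layer-avoids-321 k 2≤k pw′ ¬21543 =
  ¬21543 ∘ ⊕-contains (IsPerm⇒InRange (IsPerm-descending k)) (IsPerm⇒InRange pw′)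
                      (IsPerm⇒InRange (IsPerm-descending 2)) (IsPerm⇒InRange (IsPerm-descending 3))
                      (Contains-descending 2≤k)

[1]⊕-ascending : ∀ n σ τ → (1 ∷ []) ⊕ (ascending n ⊕ σ ⊕ τ) ≡ ascending (suc n) ⊕ σ ⊕ τ
[1]⊕-ascending n σ τ = begin
  [1] ⊕ (ascending n ⊕ σ ⊕ τ) ≡⟨ ⊕-assoc [1] _ τ ⟨
  [1] ⊕ (ascending n ⊕ σ) ⊕ τ ≡⟨ cong (_⊕ τ) (⊕-assoc [1] (ascending n) σ) ⟨
  [1] ⊕ ascending n ⊕ σ ⊕ τ   ≡⟨ cong (λ l → l ⊕ σ ⊕ τ) (ascending-suc n) ⟨
  ascending (suc n) ⊕ σ ⊕ τ   ∎
  where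
  open ≡-Reasoning
  [1] = 1 ∷ []

InAv-A₁⇒Layered : ∀ w → IsPerm w → InAv A₁ w → Acc _<_ (length w) → Layered w
InAv-A₁⇒Layered [] _ _ _ =
  0 , [] , [] , inj₁ refl ,
  (↭-refl , InAv-increasing [] (from-yes (All.all? (¬? ∘ linked? _<?_) ([2,3,1] ∷ [3,1,2] ∷ [3,2,1] ∷ [])))) ,
  refl
InAv-A₁⇒Layered w@(_ ∷ _) pw av@(¬231 ∷ ¬312 ∷ ¬4321 ∷ ¬21543 ∷ []) (acc rec)
  with first-layer pw ¬231 ¬312 (λ ())
... | 1 , w′ , _ , pw′ , eq =
  let n , σ , τ , σ-shape , fτ , eq′ = InAv-A₁⇒Layered w′ pw′ (InAv-⊕ʳ (subst (InAv A₁) eq av)) (rec shorter)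
  in suc n , σ , τ , σ-shape , fτ , trans eq (trans (cong ((1 ∷ []) ⊕_) eq′) ([1]⊕-ascending n σ τ))
  where
  shorter : length w′ < length w
  shorter = ≤-reflexive (sym (trans (cong length eq) (cong suc (length-map suc w′))))
... | 2 , w′ , _ , pw′ , eq = 0 , [] , w , inj₁ refl , (pw , ¬231 ∷ ¬312 ∷ ¬321 ∷ []) , sym (map-id w)
  where
  ¬321 : Avoids w [3,2,1]
  ¬321 c with ⊕-split-indecomposable indecomposable-321 (IsPerm⇒InRange (IsPerm-descending 2))
                (IsPerm⇒InRange pw′) (subst (λ l → Contains l [3,2,1]) eq c)
  ... | inj₁ c₂₁ = n≮n 2 (Contains-length c₂₁)
  ... | inj₂ c′  = after-layer-avoids-321 2 ≤-refl pw′ (subst (λ l → Avoids l [2,1,5,4,3]) eq ¬21543) c′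
... | suc (suc (suc (suc j))) , _ , _ , _ , eq =
  ⊥-elim (¬4321 (subst (λ l → Contains l [4,3,2,1]) (sym eq) (Contains-⊕ˡ (Contains-descending (m≤m+n 4 j)))))
... | 3 , w′ , _ , pw′ , eq with InAv-⊕ʳ (subst (InAv A₁) eq av)
...   | ¬231′ ∷ ¬312′ ∷ _ =
  0 , [3,2,1] , w′ , inj₂ refl ,
  (pw′ , ¬231′ ∷ ¬312′
       ∷ after-layer-avoids-321 3 (n≤1+n 2) pw′ (subst (λ l → Avoids l [2,1,5,4,3]) eq ¬21543) ∷ []) ,
  eq

theorem2p2 : (w : List ℕ) → IsPerm w →
    (InAv A₁ w ⇔
      Σ (List ℕ) (λ π → Σ (List ℕ) (λ σ → Σ (List ℕ) (λ τ →
        IsIncreasingPerm π ×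
        (σ ≡ [] ⊎ σ ≡ 3 ∷ 2 ∷ 1 ∷ []) ×
        IsFibonacci τ ×
        w ≡ π ⊕ σ ⊕ τ))))
theorem2p2 w pw = mk⇔ to A₁Form⇒InAv
  where
  to : InAv A₁ w → A₁Form w
  to av = let n , σ , τ , σ-shape , fτ , eq = InAv-A₁⇒Layered w pw av (<-wellFounded (length w))
          in ascending n , σ , τ , (IsPerm-ascending n , Linked-ascending n) , σ-shape , fτ , eq
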